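{- Let $\omega\in S_n$ and let $\alpha,\beta\in\mathcal{R}(\omega)$ be reduced words of $\omega$. If $\alpha<_2\beta$, then $\alpha\le_{\mathrm{lex}}\beta$.
   Context: $S_n$ is generated by the adjacent transpositions $s_i=(i,i+1)$. A word for $\omega$ is a sequence $i_1\ldots i_l$ with $\omega=s_{i_1}\cdots s_{i_l}$; it is reduced if $l$ is minimal. $\mathcal{R}(\omega)$ is the set of reduced words of $\omega$; $\le_{\mathrm{lex}}$ is the lexicographic order on words. A nonempty word $\beta_1\ldots\beta_l$ is a tower word if $\beta_i=\beta_{i-1}+1$ for all $1<i\le l$. Every nonempty word can be written uniquely as a concatenation $\mathfrak a_1\mathfrak a_2\ldots\mathfrak a_s$ of tower words such that no two consecutive $\mathfrak a_j\mathfrak a_{j+1}$ concatenate to a tower word (i.e. the maximal blocks of consecutive increasing-by-one letters); this is the tower decomposition. For a tower word $\mathfrak a$, $\mathrm{in}(\mathfrak a)$ and $\mathrm{fin}(\mathfrak a)$ denote its first and last letters, and $\widetilde{\mathfrak a}$ is the tower word obtained by adding $1$ to every letter of $\mathfrak a$. For $\alpha,\beta\in\mathcal R(\omega)$ with tower decomposition $\alpha=\mathfrak a_1\ldots\mathfrak a_s$, we write $\alpha<_2\beta$ if there is $1\le i<s$ with $\mathrm{in}(\mathfrak a_i)\le\mathrm{in}(\mathfrak a_{i+1})<\mathrm{fin}(\mathfrak a_{i+1})<\mathrm{fin}(\mathfrak a_i)$ and $\beta=\mathfrak a_1\ldots\mathfrak a_{i-1}\widetilde{\mathfrak b_1}\mathfrak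 a_i\mathfrak b_2\mathfrak a_{i+2}\ldots\mathfrak a_s$, where $\mathfrak b_1$ is a tower word and $\mathfrak b_2$ is a (possibly empty) tower word with $\mathfrak b_1\mathfrak b_2=\mathfrak a_{i+1}$. -}

module Defs where

open import Data.Nat using (ℕ; zero; suc; _≤_; _<_; _≡ᵇ_)
open import Data.Bool using (if_then_else_)
open import Data.Unit using (⊤)
open import Data.Fin using (Fin; toℕ)
open import Data.Fin.Permutation using (Permutation′; _⟨$⟩ʳ_)
open import Data.List using (List; []; _∷_; [_]; length; _++_; concat; map)
open import Data.List.Relation.Unary.All using (All)
open import Data.List.Relation.Binary.Lex.Core using (Lex-≤)
open import Data.Product using (Σ; _×_; ∃-syntax)
open import Relation.Binary.PropositionalEquality using (_≡_)

-- Words are lists of natural numbers; letter i stands for s_i = (i, i+1).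
Word : Set
Word = List ℕ

-- s_i acting on ℕ (1-based positions), fixing everything except i, i+1.
swap : ℕ → ℕ → ℕ
swap i x = if x ≡ᵇ i then suc i else (if x ≡ᵇ suc i then i else x)

eval : Word → ℕ → ℕ
eval []       x = x
eval (i ∷ w) x = swap i (eval w x)

ValidLetter : ℕ → ℕ → Set
ValidLetter n i = 1 ≤ i × i < n

-- w is a word for ω ∈ S_n (ω acts on {1,…,n} ≅ Fin n via x ↦ toℕ x + 1).
IsWordOf : (n : ℕ) → Permutation′ n → Word → Set
IsWordOf n ω w =
  All (ValidLetter n) w ×
  ((x : Fin n) → eval w (suc (toℕ x)) ≡ suc (toℕ (ω ⟨$⟩ʳ x)))

IsReducedWordOf : (n : ℕ) → Permutation′ n → Word → Set
IsReducedWordOf n ω w =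
  IsWordOf n ω w × ((v : Word) → IsWordOf n ω v → length w ≤ length v)

data IsTower : Word → Set where
  single : ∀ x → IsTower [ x ]
  step   : ∀ x {w} → IsTower (suc x ∷ w) → IsTower (x ∷ suc x ∷ w)

private
  consTower : ℕ → List Word → List Word
  consTower x ((y ∷ t) ∷ rest) =
    if y ≡ᵇ suc x then (x ∷ y ∷ t) ∷ rest else [ x ] ∷ (y ∷ t) ∷ rest
  consTower x ws = [ x ] ∷ ws

towers : Word → List Word
towers []       = []
towers (x ∷ xs) = consTower x (towers xs)

-- first letter (tower words are nonempty; the default is never used for them)
inT : Word → ℕ
inT []      = 0
inT (x ∷ _) = x

finT : Word → ℕ
finT []          = 0
finT (x ∷ [])    = x
finT (_ ∷ y ∷ w) = finT (y ∷ w)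

tilde : Word → Word
tilde = map suc

IsTowerOrEmpty : Word → Set
IsTowerOrEmpty [] = ⊤
IsTowerOrEmpty (x ∷ w) = IsTower (x ∷ w)

_<₂_ : Word → Word → Set
α <₂ β =
  ∃[ pre ] ∃[ a ] ∃[ c ] ∃[ suf ] ∃[ b₁ ] ∃[ b₂ ]
    (towers α ≡ pre ++ (a ∷ c ∷ suf)) ×
    (inT a ≤ inT c) × (inT c < finT c) × (finT c < finT a) ×
    IsTower b₁ × IsTowerOrEmpty b₂ × (b₁ ++ b₂ ≡ c) ×
    (β ≡ concat pre ++ tilde b₁ ++ a ++ b₂ ++ concat suf)

_≤lex_ : Word → Word → Set
_≤lex_ = Lex-≤ _≡_ _<_

module Submission where

open import Defs
open import Data.Nat using (ℕ; suc; _<_; _≡ᵇ_; s≤s)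
open import Data.Bool using (true; false)
open import Data.List using ([]; _∷_; _++_; concat)
open import Data.List.Properties using (concat-++)
open import Data.List.Relation.Binary.Lex.Core using (this; next)
open import Data.Product using (_,_)
open import Data.Fin.Permutation using (Permutation′)
open import Relation.Binary.PropositionalEquality using (_≡_; refl; sym; cong; subst)
open Relation.Binary.PropositionalEquality.≡-Reasoning

concat-towers : ∀ w → concat (towers w) ≡ w
concat-towers []      = refl
concat-towers (x ∷ w) with towers w | concat-towers w
... | []              | eq = cong (x ∷_) eq
... | [] ∷ _          | eq = cong (x ∷_) eq
... | (y ∷ _) ∷ _     | eq with y ≡ᵇ suc x
...   | true  = cong (x ∷_) eq
...   | false = cong (x ∷_) eq

common-prefix-<⇒≤lex : ∀ (p : Word) {x y u v} → x < y → (p ++ x ∷ u) ≤lex (p ++ y ∷ v)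
common-prefix-<⇒≤lex []      x<y = this x<y
common-prefix-<⇒≤lex (_ ∷ p) x<y = next refl (common-prefix-<⇒≤lex p x<y)

mainTheorem2 : (n : ℕ) (ω : Permutation′ n) (α β : Word) →
    IsReducedWordOf n ω α → IsReducedWordOf n ω β →
    α <₂ β → α ≤lex β
mainTheorem2 _ _ α β _ _ (pre , [] , c , suf , b₁ , b₂ , _ , _ , _ , () , _)
mainTheorem2 _ _ α β _ _
  (pre , a@(a₀ ∷ _) , c , suf , b₁@(b₀ ∷ _) , b₂ , towers-α , a₀≤b₀ , _ , _ , _ , _ , refl , refl) =
  subst (_≤lex β) α-split (common-prefix-<⇒≤lex (concat pre) (s≤s a₀≤b₀))
  where
  α-split : concat pre ++ a ++ (b₁ ++ b₂) ++ concat suf ≡ α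
  α-split = begin
    concat pre ++ a ++ (b₁ ++ b₂) ++ concat suf  ≡⟨ concat-++ pre (a ∷ (b₁ ++ b₂) ∷ suf) ⟩
    concat (pre ++ a ∷ (b₁ ++ b₂) ∷ suf)        ≡⟨ cong concat (sym towers-α) ⟩
    concat (towers α)                            ≡⟨ concat-towers α ⟩
    α                                            ∎
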